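{- Let $n\ge 5$ and $i\in\{5,\dots,n\}$. Then for every $m\in\mathbb{Z}_5$, $|V(T^{i-4,i}(n))\cap f^{ -1}(m)|=i-2$.
   Context: $f:\mathbb{Z}^2\to\mathbb{Z}_5$ is defined by $f(x,y)=(x+2y)\bmod 5$. $T(n)$ is the subgraph of the infinite integer grid (vertex set $\mathbb{Z}^2$, $(x,y)\sim(x',y')$ iff $|x-x'|+|y-y'|=1$) induced by $\{(x,y): 1\le x,y\le n,\ x\le y\}$. For $1\le k<r\le n$, $T^{k,r}(n)$ is the subgraph of $T(n)$ induced by the vertices $(x,y)$ of $T(n)$ with $k\le y\le r$. -}

module Defs where

open import Data.Nat using (ℕ; suc; _+_; _*_; _≤_; _≤?_)
open import Data.Nat.DivMod using (_mod_)
open import Data.Fin using (Fin)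
open import Data.Product using (_×_; _,_; proj₁; proj₂)
open import Data.List using (List; filter; length; cartesianProduct)
open import Data.List using (upTo; map)
open import Relation.Nullary.Decidable using (_×-dec_)
open import Data.Fin using (_≟_)

-- Grid points in ℤ²; all vertices considered here have positive coordinates,
-- so we represent points with coordinates in ℕ.
Point : Set
Point = ℕ × ℕ

f : Point → Fin 5
f (x , y) = (x + 2 * y) mod 5

range1 : ℕ → List ℕ
range1 n = map suc (upTo n)

-- Membership in V(T^{k,r}(n)): 1 ≤ x,y ≤ n, x ≤ y, k ≤ y ≤ r.
InT : ℕ → ℕ → ℕ → Point → Set
InT n k r (x , y) = (1 ≤ x × x ≤ n) × (1 ≤ y × y ≤ n) × (x ≤ y) × (k ≤ y × y ≤ r)

inT? : ∀ n k r (p : Point) → Relation.Nullary.Decidable.Dec (InT n k r p)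
inT? n k r (x , y) =
  ((1 ≤? x) ×-dec (x ≤? n)) ×-dec ((1 ≤? y) ×-dec (y ≤? n)) ×-dec (x ≤? y)
    ×-dec ((k ≤? y) ×-dec (y ≤? r))
  where open import Relation.Nullary.Decidable

-- The vertex set V(T^{k,r}(n)), as a duplicate-free list (enumerated from [1..n]²).
VT : ℕ → ℕ → ℕ → List Point
VT n k r = filter (inT? n k r) (cartesianProduct (range1 n) (range1 n))

countColour : ℕ → ℕ → ℕ → Fin 5 → ℕ
countColour n k r m = length (filter (λ p → f p ≟ m) (VT n k r))

module Submission where

-- Write i = 5 + j, so T^{i-4,i}(n) is the strip of the triangle
-- with rows y = j+1, …, j+5 (all of which exist since j + 5 ≤ n).
-- Counting column by column:
--   * a column x with 1 ≤ x ≤ j meets the strip in the five consecutive rows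
--     j+1, …, j+5; along them x + 2y runs through an arithmetic progression of
--     step 2, which is a unit mod 5, so every colour appears exactly once;
--   * the columns x = u + j (1 ≤ u ≤ 5) meet the strip in the cells
--     (u + j, c + j) with u ≤ c ≤ 5, of colour u + 2c + 3j; these 15 cells
--     carry every colour exactly 3 times;
--   * all other columns miss the strip.
-- Hence each colour occurs j + 3 = i - 2 times.

open import Defs
open import Data.Nat using (ℕ; zero; suc; _+_; _*_; _∸_; _≤_; _<_; _≤?_; z≤n; s≤s)
open import Data.Nat.Properties
  using (+-assoc; +-comm; +-identityʳ; *-zeroʳ; *-identityʳ; ≤-refl; ≤-trans; ≤-<-trans;
         <⇒≱; m≤n+m; m<n⇒m<1+n; m≤n⇒m<n∨m≡n; +-monoˡ-≤; +-monoˡ-<; ≰⇒>)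
import Data.Nat as ℕ using (_≟_)
open import Data.Nat.DivMod using (_%_; _/_; _mod_; m%n<n; m≡m%n+[m/n]*n; [m+kn]%n≡m%n)
open import Data.Nat.ListAction using (sum)
open import Data.Nat.ListAction.Properties using (sum-++)
open import Data.Nat.Solver using (module +-*-Solver)
open import Data.Fin using (Fin; toℕ; _≟_)
open import Data.Fin.Properties using (all?; toℕ-fromℕ<; fromℕ<-cong)
open import Data.List using (List; []; _∷_; _++_; [_]; map; filter; length; upTo; cartesianProduct)
open import Data.List.Properties using (map-++; map-cong; map-∘; upTo-∷ʳ)
open import Data.Product using (_×_; _,_)
open import Data.Sum using (inj₁; inj₂)
open import Data.Bool using (true; false; if_then_else_)
open import Level using (0ℓ)
open import Relation.Nullary using (¬_; does; yes; no)
open import Relation.Nullary.Decidable using (dec-true; dec-false; from-yes)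
open import Relation.Unary using (Pred; Decidable)
open import Relation.Binary.PropositionalEquality
  using (_≡_; refl; sym; trans; cong; cong₂; module ≡-Reasoning)
open ≡-Reasoning

sumTo : ℕ → (ℕ → ℕ) → ℕ
sumTo zero    g = 0
sumTo (suc N) g = sumTo N g + g (suc N)

sumTo-cong : ∀ N {g h : ℕ → ℕ} → (∀ c → c < N → g (suc c) ≡ h (suc c)) →
  sumTo N g ≡ sumTo N h
sumTo-cong zero    eq = refl
sumTo-cong (suc N) eq = cong₂ _+_ (sumTo-cong N (λ c c<N → eq c (m<n⇒m<1+n c<N))) (eq N ≤-refl)

sumTo-const : ∀ N c → sumTo N (λ _ → c) ≡ N * c
sumTo-const zero    c = refl
sumTo-const (suc N) c = trans (cong (_+ c) (sumTo-const N c)) (+-comm (N * c) c)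

sumTo-zero : ∀ N {g : ℕ → ℕ} → (∀ c → c < N → g (suc c) ≡ 0) → sumTo N g ≡ 0
sumTo-zero N vanish = trans (sumTo-cong N vanish) (trans (sumTo-const N 0) (*-zeroʳ N))

sumTo-split : ∀ w a g → sumTo (w + a) g ≡ sumTo a g + sumTo w (λ c → g (c + a))
sumTo-split zero    a g = sym (+-identityʳ (sumTo a g))
sumTo-split (suc w) a g =
  trans (cong (_+ g (suc w + a)) (sumTo-split w a g)) (+-assoc (sumTo a g) _ _)

sumTo-trunc : ∀ {a} N g → (∀ y → a < y → g y ≡ 0) → a ≤ N → sumTo N g ≡ sumTo a g
sumTo-trunc N g vanish a≤N with m≤n⇒m<n∨m≡n a≤N
... | inj₂ refl = refl
sumTo-trunc {a} (suc N) g vanish _ | inj₁ (s≤s a≤N) = begin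
  sumTo N g + g (suc N) ≡⟨ cong₂ _+_ (sumTo-trunc N g vanish a≤N) (vanish (suc N) (s≤s a≤N)) ⟩
  sumTo a g + 0         ≡⟨ +-identityʳ (sumTo a g) ⟩
  sumTo a g             ∎

range1-snoc : ∀ N → range1 (suc N) ≡ range1 N ++ [ suc N ]
range1-snoc N = trans (cong (map suc) (sym (upTo-∷ʳ N))) (map-++ suc (upTo N) [ N ])

sum-range1 : ∀ N g → sum (map g (range1 N)) ≡ sumTo N g
sum-range1 zero    g = refl
sum-range1 (suc N) g = begin
  sum (map g (range1 (suc N)))             ≡⟨ cong (λ xs → sum (map g xs)) (range1-snoc N) ⟩
  sum (map g (range1 N ++ [ suc N ]))      ≡⟨ cong sum (map-++ g (range1 N) [ suc N ]) ⟩
  sum (map g (range1 N) ++ [ g (suc N) ])  ≡⟨ sum-++ (map g (range1 N)) [ g (suc N) ] ⟩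
  sum (map g (range1 N)) + (g (suc N) + 0) ≡⟨ cong₂ _+_ (sum-range1 N g) (+-identityʳ (g (suc N))) ⟩
  sumTo N g + g (suc N)                    ∎

sum-cartesianProduct : ∀ {A B : Set} (g : A × B → ℕ) (xs : List A) (ys : List B) →
  sum (map g (cartesianProduct xs ys)) ≡ sum (map (λ x → sum (map (λ y → g (x , y)) ys)) xs)
sum-cartesianProduct g []       ys = refl
sum-cartesianProduct g (x ∷ xs) ys = begin
  sum (map g (map (x ,_) ys ++ cartesianProduct xs ys))
    ≡⟨ cong sum (map-++ g (map (x ,_) ys) (cartesianProduct xs ys)) ⟩
  sum (map g (map (x ,_) ys) ++ map g (cartesianProduct xs ys))
    ≡⟨ sum-++ (map g (map (x ,_) ys)) (map g (cartesianProduct xs ys)) ⟩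
  sum (map g (map (x ,_) ys)) + sum (map g (cartesianProduct xs ys))
    ≡⟨ cong₂ _+_ (cong sum (sym (map-∘ ys))) (sum-cartesianProduct g xs ys) ⟩
  sum (map (λ y → g (x , y)) ys) + sum (map (λ x → sum (map (λ y → g (x , y)) ys)) xs) ∎

indicator : ∀ {A : Set} {P : Pred A 0ℓ} → Decidable P → A → ℕ
indicator P? x = if does (P? x) then 1 else 0

length-filter : ∀ {A : Set} {P : Pred A 0ℓ} (P? : Decidable P) xs →
  length (filter P? xs) ≡ sum (map (indicator P?) xs)
length-filter P? []       = refl
length-filter P? (x ∷ xs) with does (P? x)
... | true  = cong suc (length-filter P? xs)
... | false = length-filter P? xs

sum-filter : ∀ {A : Set} {P : Pred A 0ℓ} (P? : Decidable P) (h : A → ℕ) xs →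
  sum (map h (filter P? xs)) ≡ sum (map (λ x → if does (P? x) then h x else 0) xs)
sum-filter P? h []       = refl
sum-filter P? h (x ∷ xs) with does (P? x)
... | true  = cong (h x +_) (sum-filter P? h xs)
... | false = sum-filter P? h xs

colourHit : Fin 5 → Fin 5 → ℕ
colourHit m c = if does (c ≟ m) then 1 else 0

mod5-shift : ∀ k t → (k + t) mod 5 ≡ (k + toℕ (t mod 5)) mod 5
mod5-shift k t = fromℕ<-cong _ _ (begin
  (k + t) % 5                   ≡⟨ cong (λ s → (k + s) % 5) (m≡m%n+[m/n]*n t 5) ⟩
  (k + (t % 5 + t / 5 * 5)) % 5 ≡⟨ cong (_% 5) (sym (+-assoc k (t % 5) (t / 5 * 5))) ⟩
  (k + t % 5 + t / 5 * 5) % 5   ≡⟨ [m+kn]%n≡m%n (k + t % 5) (t / 5) 5 ⟩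
  (k + t % 5) % 5               ≡⟨ cong (λ s → (k + s) % 5) (sym (toℕ-fromℕ< (m%n<n t 5))) ⟩
  (k + toℕ (t mod 5)) % 5       ∎) _ _

-- Five consecutive cells of a column: the progression 2c + t (c = 1..5)
-- hits every residue mod 5 exactly once (2 is a unit mod 5).
fullColumnColours : ∀ t m → sumTo 5 (λ c → colourHit m ((2 * c + t) mod 5)) ≡ 1
fullColumnColours t m = begin
  sumTo 5 (λ c → colourHit m ((2 * c + t) mod 5))
    ≡⟨ sumTo-cong 5 {λ c → colourHit m ((2 * c + t) mod 5)}
                    {λ c → colourHit m ((2 * c + t′) mod 5)}
         (λ c _ → cong (colourHit m) (mod5-shift (2 * suc c) t)) ⟩
  sumTo 5 (λ c → colourHit m ((2 * c + t′) mod 5))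
    ≡⟨ table (t mod 5) m ⟩
  1 ∎
  where
  t′ : ℕ
  t′ = toℕ (t mod 5)
  table : ∀ s m → sumTo 5 (λ c → colourHit m ((2 * c + toℕ s) mod 5)) ≡ 1
  table = from-yes (all? λ (s : Fin 5) → all? λ (m : Fin 5) →
            sumTo 5 (λ c → colourHit m ((2 * c + toℕ s) mod 5)) ℕ.≟ 1)

triCell : Fin 5 → ℕ → ℕ → ℕ → ℕ
triCell m t u c = if does (u ≤? c) then colourHit m ((u + 2 * c + t) mod 5) else 0

triCell-≤ : ∀ m t {u c} → u ≤ c → triCell m t u c ≡ colourHit m ((u + 2 * c + t) mod 5)
triCell-≤ m t {u} {c} u≤c =
  cong (if_then colourHit m ((u + 2 * c + t) mod 5) else 0) (dec-true (u ≤? c) u≤c)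

triCell-≰ : ∀ m t {u c} → ¬ u ≤ c → triCell m t u c ≡ 0
triCell-≰ m t {u} {c} u≰c =
  cong (if_then colourHit m ((u + 2 * c + t) mod 5) else 0) (dec-false (u ≤? c) u≰c)

triangleColours : ∀ t m → sumTo 5 (λ u → sumTo 5 (λ c → triCell m t u c)) ≡ 3
triangleColours t m = begin
  sumTo 5 (λ u → sumTo 5 (λ c → triCell m t u c))
    ≡⟨ sumTo-cong 5 {λ u → sumTo 5 (triCell m t u)} {λ u → sumTo 5 (triCell m t′ u)}
         (λ u _ → sumTo-cong 5 {triCell m t (suc u)} {triCell m t′ (suc u)} (λ c _ →
         cong (λ h → if does (suc u ≤? suc c) then h else 0)
              (cong (colourHit m) (mod5-shift (suc u + 2 * suc c) t)))) ⟩
  sumTo 5 (λ u → sumTo 5 (λ c → triCell m t′ u c))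
    ≡⟨ table (t mod 5) m ⟩
  3 ∎
  where
  t′ : ℕ
  t′ = toℕ (t mod 5)
  table : ∀ s m → sumTo 5 (λ u → sumTo 5 (λ c → triCell m (toℕ s) u c)) ≡ 3
  table = from-yes (all? λ (s : Fin 5) → all? λ (m : Fin 5) →
            sumTo 5 (λ u → sumTo 5 (λ c → triCell m (toℕ s) u c)) ℕ.≟ 3)

module Strip (n k r : ℕ) (m : Fin 5) where

  χ : Point → ℕ
  χ p = if does (inT? n k r p) then colourHit m (f p) else 0

  χ-out : ∀ p → ¬ InT n k r p → χ p ≡ 0
  χ-out p ¬in rewrite dec-false (inT? n k r p) ¬in = refl

  χ-in : ∀ p → InT n k r p → χ p ≡ colourHit m (f p)
  χ-in p inT rewrite dec-true (inT? n k r p) inT = refl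

  column : ℕ → ℕ
  column x = sumTo n (λ y → χ (x , y))

  countColour-columns : countColour n k r m ≡ sumTo n column
  countColour-columns = begin
    countColour n k r m
      ≡⟨ length-filter (λ p → f p ≟ m) (VT n k r) ⟩
    sum (map (λ p → colourHit m (f p)) (VT n k r))
      ≡⟨ sum-filter (inT? n k r) (λ p → colourHit m (f p)) grid ⟩
    sum (map χ grid)
      ≡⟨ sum-cartesianProduct χ (range1 n) (range1 n) ⟩
    sum (map (λ x → sum (map (λ y → χ (x , y)) (range1 n))) (range1 n))
      ≡⟨ cong sum (map-cong (λ x → sum-range1 n (λ y → χ (x , y))) (range1 n)) ⟩
    sum (map column (range1 n))
      ≡⟨ sum-range1 n column ⟩
    sumTo n column ∎
    where
    grid : List Point
    grid = cartesianProduct (range1 n) (range1 n)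

module FiveRowStrip (n j : ℕ) (hn : 5 + j ≤ n) (m : Fin 5) where
  open Strip n (suc j) (5 + j) m
  open +-*-Solver

  χ-below : ∀ x {y} → y ≤ j → χ (x , y) ≡ 0
  χ-below x {y} y≤j = χ-out (x , y) λ (_ , _ , _ , j<y , _) → <⇒≱ j<y y≤j

  χ-above : ∀ x {y} → 5 + j < y → χ (x , y) ≡ 0
  χ-above x {y} r<y = χ-out (x , y) λ (_ , _ , _ , _ , y≤r) → <⇒≱ r<y y≤r

  χ-lower : ∀ x {y} → y < x → χ (x , y) ≡ 0
  χ-lower x {y} y<x = χ-out (x , y) λ (_ , _ , x≤y , _) → <⇒≱ y<x x≤y

  χ-window : ∀ {x y} → 1 ≤ x → x ≤ y → suc j ≤ y → y ≤ 5 + j →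
    χ (x , y) ≡ colourHit m (f (x , y))
  χ-window {x} {y} 1≤x x≤y k≤y y≤r =
    χ-in (x , y) ((1≤x , ≤-trans x≤y y≤n) , (≤-trans (s≤s z≤n) k≤y , y≤n) , x≤y , k≤y , y≤r)
    where
    y≤n : y ≤ n
    y≤n = ≤-trans y≤r hn

  column-window : ∀ x → column x ≡ sumTo 5 (λ c → χ (x , c + j))
  column-window x = begin
    sumTo n row                                  ≡⟨ sumTo-trunc n row (λ _ → χ-above x) hn ⟩
    sumTo (5 + j) row                            ≡⟨ sumTo-split 5 j row ⟩
    sumTo j row + sumTo 5 (λ c → row (c + j))    ≡⟨ cong (_+ sumTo 5 (λ c → row (c + j)))
                                                         (sumTo-zero j (λ _ c<j → χ-below x c<j)) ⟩
    sumTo 5 (λ c → row (c + j))                  ∎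
    where
    row : ℕ → ℕ
    row y = χ (x , y)

  column-beyond : ∀ x → 5 + j < x → column x ≡ 0
  column-beyond x r<x = trans (column-window x)
    (sumTo-zero 5 {λ c → χ (x , c + j)}
      (λ c c<5 → χ-lower x (≤-<-trans (+-monoˡ-≤ j c<5) r<x)))

  column-full : ∀ x → 1 ≤ x → x ≤ j → column x ≡ 1
  column-full x 1≤x x≤j = begin
    column x                        ≡⟨ column-window x ⟩
    sumTo 5 (λ c → χ (x , c + j))   ≡⟨ sumTo-cong 5 {λ c → χ (x , c + j)} {progression} cell ⟩
    sumTo 5 progression             ≡⟨ fullColumnColours (x + 2 * j) m ⟩
    1                               ∎
    where
    progression : ℕ → ℕ
    progression c = colourHit m ((2 * c + (x + 2 * j)) mod 5)
    colour : ∀ c → x + 2 * (c + j) ≡ 2 * c + (x + 2 * j)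
    colour c = solve 3 (λ x c j → x :+ con 2 :* (c :+ j) := con 2 :* c :+ (x :+ con 2 :* j)) refl x c j
    cell : ∀ c → c < 5 → χ (x , suc c + j) ≡ progression (suc c)
    cell c c<5 = trans
      (χ-window 1≤x (≤-trans x≤j (m≤n+m j (suc c))) (s≤s (m≤n+m j c)) (+-monoˡ-≤ j c<5))
      (cong (λ z → colourHit m (z mod 5)) (colour (suc c)))

  χ-triangle : ∀ u c → c < 5 → χ (suc u + j , suc c + j) ≡ triCell m (3 * j) (suc u) (suc c)
  χ-triangle u c c<5 with suc u ≤? suc c
  ... | yes u≤c = begin
    χ (suc u + j , suc c + j)
      ≡⟨ χ-window (s≤s z≤n) (+-monoˡ-≤ j u≤c) (s≤s (m≤n+m j c)) (+-monoˡ-≤ j c<5) ⟩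
    colourHit m (((suc u + j) + 2 * (suc c + j)) mod 5)
      ≡⟨ cong (λ z → colourHit m (z mod 5)) (colour (suc u) (suc c) j) ⟩
    colourHit m ((suc u + 2 * suc c + 3 * j) mod 5)
      ≡⟨ triCell-≤ m (3 * j) u≤c ⟨
    triCell m (3 * j) (suc u) (suc c) ∎
    where
    colour : ∀ u c j → (u + j) + 2 * (c + j) ≡ (u + 2 * c) + 3 * j
    colour = solve 3 (λ u c j → (u :+ j) :+ con 2 :* (c :+ j) := (u :+ con 2 :* c) :+ con 3 :* j) refl
  ... | no u≰c = begin
    χ (suc u + j , suc c + j)         ≡⟨ χ-lower (suc u + j) (+-monoˡ-< j (≰⇒> u≰c)) ⟩
    0                                 ≡⟨ triCell-≰ m (3 * j) u≰c ⟨
    triCell m (3 * j) (suc u) (suc c) ∎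

  triangle : sumTo 5 (λ u → column (u + j)) ≡ 3
  triangle = begin
    sumTo 5 (λ u → column (u + j))
      ≡⟨ sumTo-cong 5 {λ u → column (u + j)} {λ u → sumTo 5 (triCell m (3 * j) u)}
           (λ u _ → trans (column-window (suc u + j))
             (sumTo-cong 5 {λ c → χ (suc u + j , c + j)} {triCell m (3 * j) (suc u)}
               (λ c c<5 → χ-triangle u c c<5))) ⟩
    sumTo 5 (λ u → sumTo 5 (λ c → triCell m (3 * j) u c))
      ≡⟨ triangleColours (3 * j) m ⟩
    3 ∎

  count : countColour n (suc j) (5 + j) m ≡ 3 + j
  count = begin
    countColour n (suc j) (5 + j) m ≡⟨ countColour-columns ⟩
    sumTo n column                  ≡⟨ sumTo-trunc n column column-beyond hn ⟩
    sumTo (5 + j) column            ≡⟨ sumTo-split 5 j column ⟩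
    sumTo j column + sumTo 5 (λ u → column (u + j))
      ≡⟨ cong₂ _+_ (sumTo-cong j (λ x x<j → column-full (suc x) (s≤s z≤n) x<j)) triangle ⟩
    sumTo j (λ _ → 1) + 3           ≡⟨ cong (_+ 3) (trans (sumTo-const j 1) (*-identityʳ j)) ⟩
    j + 3                           ≡⟨ +-comm j 3 ⟩
    3 + j                           ∎

proposition2p2 : (n i : ℕ) → 5 ≤ n → 5 ≤ i → i ≤ n →
    (m : Fin 5) → countColour n (i ∸ 4) i m ≡ i ∸ 2
proposition2p2 n (suc (suc (suc (suc (suc j))))) _ (s≤s (s≤s (s≤s (s≤s (s≤s _))))) i≤n m =
  FiveRowStrip.count n j i≤n m
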